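{- For all integers $4\le a\le b$, there exists a connected graph $G$ such that $rvc(G)=a$ and $srvc(G)=b$.
   Context: All graphs are finite and simple. A vertex-coloured path is vertex-rainbow if its internal vertices have distinct colours. $rvc(G)$ is the minimum number of colours in a vertex-colouring in which any two vertices are joined by a vertex-rainbow path; $srvc(G)$ is the minimum number of colours in a vertex-colouring in which any two vertices $u,v$ are joined by a vertex-rainbow $u$–$v$ geodesic (a $u$–$v$ path of length $d(u,v)$). -}

module Defs where

open import Data.Nat using (ℕ; zero; suc; _≤_; _<_)
open import Data.Fin using (Fin)
open import Data.Bool using (Bool; true; false)
open import Data.List using (List; []; _∷_; map)
open import Data.List.Relation.Unary.Unique.Propositional using (Unique)
open import Data.Product using (Σ; _×_; ∃)
open import Relation.Binary.PropositionalEquality using (_≡_)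
open import Relation.Nullary using (¬_)

record Graph (n : ℕ) : Set where
  field
    adj     : Fin n → Fin n → Bool
    symm    : ∀ u v → adj u v ≡ adj v u
    irrefl  : ∀ u → adj u u ≡ false

module _ {n : ℕ} (G : Graph n) where
  open Graph G

  Adj : Fin n → Fin n → Set
  Adj u v = adj u v ≡ true

  data Walk : Fin n → Fin n → Set where
    here : ∀ u → Walk u u
    step : ∀ {v} u w → Adj u w → Walk w v → Walk u v

  len : ∀ {u v} → Walk u v → ℕ
  len (here _)       = 0
  len (step _ _ _ p) = suc (len p)

  vertices : ∀ {u v} → Walk u v → List (Fin n)
  vertices (here u)       = u ∷ []
  vertices (step u _ _ p) = u ∷ vertices p

  initVertices : ∀ {u v} → Walk u v → List (Fin n)
  initVertices (here _)       = []
  initVertices (step u _ _ p) = u ∷ initVertices p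

  internal : ∀ {u v} → Walk u v → List (Fin n)
  internal (here _)       = []
  internal (step _ _ _ p) = initVertices p

  IsPath : ∀ {u v} → Walk u v → Set
  IsPath p = Unique (vertices p)

  Connected : Set
  Connected = ∀ u v → Σ (Walk u v) IsPath

  IsGeodesic : ∀ {u v} → Walk u v → Set
  IsGeodesic {u} {v} p = IsPath p × (∀ (q : Walk u v) → IsPath q → len p ≤ len q)

  VertexRainbow : ∀ {k u v} → (Fin n → Fin k) → Walk u v → Set
  VertexRainbow c p = Unique (map c (internal p))

  -- colourings with (at most) k colours
  RainbowVertexConnected : ∀ {k} → (Fin n → Fin k) → Set
  RainbowVertexConnected c =
    ∀ u v → Σ (Walk u v) λ p → IsPath p × VertexRainbow c p

  StrongRainbowVertexConnected : ∀ {k} → (Fin n → Fin k) → Set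
  StrongRainbowVertexConnected c =
    ∀ u v → Σ (Walk u v) λ p → IsGeodesic p × VertexRainbow c p

  rvc≡ : ℕ → Set
  rvc≡ a = (∃ λ (c : Fin n → Fin a) → RainbowVertexConnected c)
         × (∀ k → k < a → ¬ (∃ λ (c : Fin n → Fin k) → RainbowVertexConnected c))

  srvc≡ : ℕ → Set
  srvc≡ b = (∃ λ (c : Fin n → Fin b) → StrongRainbowVertexConnected c)
          × (∀ k → k < b → ¬ (∃ λ (c : Fin n → Fin k) → StrongRainbowVertexConnected c))

-- The graph is a bouquet around a hub: m = a - 1 arms (paths hub–stem–leaf) and t = b - a
-- five-cycles through the hub (hub–c₁–c₂–c₃–c₄–hub).  Every vertex is within distance two of
-- the hub, and a walk can leave a branch only through the hub.  Hence vertices of one branch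
-- (or the hub) are joined by a route of length at most two, which is rainbow for any colouring,
-- and vertices of different branches by the two routes to the hub glued at the hub, which is a
-- geodesic when both routes are shortest.  Colouring the hub-neighbours of each branch (its stem, or its c₁ and c₄) with
--   a colour of that branch makes all glued shortest routes rainbow: srvc ≤ 1 + m + t.  With only
--   1 + m colours (m ≥ 3), a cycle vertex goes the long way round its 5-cycle whenever its short
--   route would repeat the colour met on the other end's route: rvc ≤ 1 + m.  A rainbow walk between two leaves passes both stems and the hub, so the hub and
--   the m stems need distinct colours.  A geodesic from c₂ of a cycle branch to a vertex at
--   distance two from the hub on another branch has length four, so it leaves through c₁; hence
--   the t vertices c₁ need further colours of their own: srvc ≥ 1 + m + t.
module Submission where

open import Defs
open import Data.Nat as ℕ using (ℕ; suc; _+_; _*_; _≤_; _<_; z≤n; s≤s; ∣_-_∣)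
open import Data.Nat.Properties
  using ( ≤-trans; ≤-reflexive; +-monoˡ-≤; +-monoʳ-≤; <-≤-trans; n≮n; <⇒≱; m≤n⇒∃[o]m+o≡n
        ; ∣-∣-comm; ∣n-n∣≡0)
open import Data.Fin using (Fin; zero; suc; toℕ; join; splitAt; combine; remQuot) renaming (_≟_ to _≟ᶠ_)
open import Data.Fin.Properties
  using (injective⇒≤; suc-injective; splitAt-join; join-splitAt; remQuot-combine; combine-remQuot)
open import Data.Bool using (Bool; true; false; _∧_)
open import Data.Sum using (_⊎_; inj₁; inj₂)
import Data.Sum.Properties as SumP
open import Data.Product using (Σ; _×_; _,_; proj₁; proj₂; uncurry)
open import Data.List using (List; []; _∷_; map; _++_; reverse; length)
open import Data.List.Properties using (++-assoc; unfold-reverse; length-++; length-reverse; map-++; reverse-map)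
open import Data.List.Relation.Unary.Any using (here; there)
open import Data.List.Relation.Unary.All as All using (All; []; _∷_)
import Data.List.Relation.Unary.All.Properties as AllP
open import Data.List.Relation.Unary.AllPairs using ([]; _∷_)
open import Data.List.Relation.Unary.Unique.Propositional using (Unique)
import Data.List.Relation.Unary.Unique.Propositional.Properties as UniqueP
open import Data.List.Membership.Propositional using (_∈_; _∉_)
open import Data.List.Membership.Propositional.Properties using (∈-map⁺)
open import Data.List.Relation.Binary.Disjoint.Propositional using (Disjoint)
import Data.List.Relation.Binary.Disjoint.Propositional.Properties as DisjointP
open import Data.Empty using (⊥-elim)
open import Function using (_∘_)
open import Relation.Binary.PropositionalEquality
open ≡-Reasoning
open import Relation.Nullary using (¬_; Dec; does; yes; no; ¬?)
open import Relation.Nullary.Decidable using (decidable-stable; dec-true)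
open import Relation.Unary using (Pred; Decidable)

map-unique-injective : ∀ {A B : Set} (f : A → B) {xs : List A} → Unique (map f xs) →
                       ∀ {x y} → x ∈ xs → y ∈ xs → f x ≡ f y → x ≡ y
map-unique-injective f (_ ∷ _)  (here refl) (here refl) _ = refl
map-unique-injective f (fx∉ ∷ _) (here refl) (there y∈) e =
  ⊥-elim (All.lookup fx∉ (∈-map⁺ f y∈) e)
map-unique-injective f (fx∉ ∷ _) (there x∈) (here refl) e =
  ⊥-elim (All.lookup fx∉ (∈-map⁺ f x∈) (sym e))
map-unique-injective f (_ ∷ u)  (there x∈) (there y∈) e = map-unique-injective f u x∈ y∈ e

unique-prefix : ∀ {A : Set} (xs : List A) {ys} → Unique (xs ++ ys) → Unique xs
unique-prefix []       _          = []
unique-prefix (_ ∷ xs) (x∉ ∷ u)   = AllP.++⁻ˡ xs x∉ ∷ unique-prefix xs u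

module _ {A : Set} where
  open import Data.List.Relation.Binary.Permutation.Setoid (setoid A) using (↭-sym)
  open import Data.List.Relation.Binary.Permutation.Setoid.Properties (setoid A)
    using (Unique-resp-↭; ∈-resp-↭; ↭-reverse)

  unique-reverse : {xs : List A} → Unique xs → Unique (reverse xs)
  unique-reverse = Unique-resp-↭ (↭-sym (↭-reverse _))

  ∈-reverse : {x : A} {xs : List A} → x ∈ reverse xs → x ∈ xs
  ∈-reverse = ∈-resp-↭ (↭-reverse _)

  unique-join : ∀ {as bs : List A} {h} → Unique as → Unique bs → h ∉ as → h ∉ bs → Disjoint as bs →
                Unique (as ++ h ∷ reverse bs)
  unique-join {as} {bs} {h} ua ub h∉as h∉bs as#bs =
    UniqueP.++⁺ ua (h-fresh ∷ unique-reverse ub) disjoint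
    where
    h-fresh : All (h ≢_) (reverse bs)
    h-fresh = All.tabulate λ z∈ h≡z → h∉bs (subst (_∈ bs) (sym h≡z) (∈-reverse z∈))
    disjoint : Disjoint as (h ∷ reverse bs)
    disjoint (z∈as , here refl)   = h∉as z∈as
    disjoint (z∈as , there z∈bs)  = as#bs (z∈as , ∈-reverse z∈bs)

constant-∉ : ∀ {A : Set} {a h : A} {as} → All (_≡ a) as → h ≢ a → h ∉ as
constant-∉ all h≢a h∈ = h≢a (All.lookup all h∈)

constant-disjoint : ∀ {A : Set} {a b : A} {as bs} → All (_≡ a) as → All (_≡ b) bs → a ≢ b → Disjoint as bs
constant-disjoint A B a≢b (z∈as , z∈bs) = a≢b (trans (sym (All.lookup A z∈as)) (All.lookup B z∈bs))

avoiding-disjoint : ∀ {A : Set} {a : A} {as bs} → a ∉ as → All (_≡ a) bs → Disjoint as bs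
avoiding-disjoint a∉as B (z∈as , z∈bs) = a∉as (subst (_∈ _) (All.lookup B z∈bs) z∈as)

distinct-colours : ∀ {a k} {A : Set} (f : Fin a → A) (c : A → Fin k) →
                   (∀ i j → i ≢ j → c (f i) ≢ c (f j)) → a ≤ k
distinct-colours f c separated = injective⇒≤ injective
  where
  injective : ∀ {i j} → c (f i) ≡ c (f j) → i ≡ j
  injective {i} {j} same with i ≟ᶠ j
  ... | yes i≡j = i≡j
  ... | no i≢j  = ⊥-elim (separated i j i≢j same)

module WalkFacts {n : ℕ} (G : Graph n) where

  split : ∀ {u v x} (p : Walk G u v) → x ∈ vertices G p →
          Σ (Walk G u x) λ a → Σ (Walk G x v) λ b → len G a + len G b ≡ len G p
  split (here u)       (here refl) = here u , here u , refl
  split (step u w e p) (here refl) = here u , step u w e p , refl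
  split (step u w e p) (there x∈) with split p x∈
  ... | a , b , sum = step u w e a , b , cong suc sum

  MinLen : ℕ → Fin n → Fin n → Set
  MinLen d u v = (p : Walk G u v) → d ≤ len G p

  minLen-distinct : ∀ {u v} → u ≢ v → MinLen 1 u v
  minLen-distinct u≢v (here _)       = ⊥-elim (u≢v refl)
  minLen-distinct u≢v (step _ _ _ _) = s≤s z≤n

  minLen-nonadjacent : ∀ {u v} → u ≢ v → ¬ Adj G u v → MinLen 2 u v
  minLen-nonadjacent u≢v _  (here _)                  = ⊥-elim (u≢v refl)
  minLen-nonadjacent _ ¬uv (step _ _ e (here _))      = ⊥-elim (¬uv e)
  minLen-nonadjacent _ _   (step _ _ _ (step _ _ _ _)) = s≤s (s≤s z≤n)

  visit-length : ∀ {a b u v x} (p : Walk G u v) → x ∈ vertices G p →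
                 MinLen a u x → MinLen b x v → a + b ≤ len G p
  visit-length {a} {b} p x∈ ux xv with split p x∈
  ... | r , s , sum =
    ≤-trans (≤-trans (+-monoˡ-≤ b (ux r)) (+-monoʳ-≤ (len G r) (xv s))) (≤-reflexive sum)

  minLen-via : ∀ {a b u v x} → (∀ (p : Walk G u v) → x ∈ vertices G p) →
               MinLen a u x → MinLen b x v → MinLen (a + b) u v
  minLen-via through ux xv p = visit-length p (through p) ux xv

  avoids : ∀ {a b u v x} (p : Walk G u v) → len G p < a + b →
           MinLen a u x → MinLen b x v → x ∉ vertices G p
  avoids p short ux xv x∈ = n≮n _ (<-≤-trans short (visit-length p x∈ ux xv))

  geodesic : ∀ {u v} (p : Walk G u v) → IsPath G p → MinLen (len G p) u v → IsGeodesic G p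
  geodesic p path shortest = path , λ r _ → shortest r

  stay-geodesic : ∀ u → IsGeodesic G (here u)
  stay-geodesic u = [] ∷ [] , λ _ _ → z≤n

  start∈ : ∀ {u v} (p : Walk G u v) → u ∈ vertices G p
  start∈ (here _)       = here refl
  start∈ (step _ _ _ _) = here refl

  strong⇒rainbow : ∀ {k} {c : Fin n → Fin k} → StrongRainbowVertexConnected G c → RainbowVertexConnected G c
  strong⇒rainbow sc u v with sc u v
  ... | p , (path , _) , rainbow = p , path , rainbow

  record Exit {u v} (P : Pred (Fin n) _) (p : Walk G u v) : Set where
    field
      from to  : Fin n
      from∈    : from ∈ vertices G p
      to∈      : to ∈ vertices G p
      edge     : Adj G from to
      inside   : P from
      outside  : ¬ P to

  exit : ∀ {P : Pred (Fin n) _} → Decidable P → ∀ {u v} (p : Walk G u v) → P u → ¬ P v → Exit P p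
  exit P? (here u)       Pu ¬Pv = ⊥-elim (¬Pv Pu)
  exit P? (step u w e p) Pu ¬Pv with P? w
  ... | no ¬Pw = record { from∈ = here refl ; to∈ = there (start∈ p) ; edge = e ; inside = Pu ; outside = ¬Pw }
  ... | yes Pw = let open Exit (exit P? p Pw ¬Pv) in
    record { from∈ = there from∈ ; to∈ = there to∈ ; edge = edge ; inside = inside ; outside = outside }

  leaves-via : ∀ {P : Pred (Fin n) _} → Decidable P → ∀ {u v x} (p : Walk G u v) →
               (∀ y z → Adj G y z → P y → ¬ P z → z ∈ vertices G p → z ≡ x) →
               P u → ¬ P v → x ∈ vertices G p
  leaves-via P? p only Pu ¬Pv = subst (_∈ vertices G p) (only from to edge inside outside to∈) to∈
    where open Exit (exit P? p Pu ¬Pv)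

  enters-via : ∀ {P : Pred (Fin n) _} → Decidable P → ∀ {u v x} (p : Walk G u v) →
               (∀ y z → Adj G y z → ¬ P y → P z → y ∈ vertices G p → y ≡ x) →
               ¬ P u → P v → x ∈ vertices G p
  enters-via {P} P? p only ¬Pu Pv =
    subst (_∈ vertices G p) (only from to edge inside (decidable-stable (P? to) outside) from∈) from∈
    where open Exit (exit (λ z → ¬? (P? z)) p ¬Pu (λ ¬Pv → ¬Pv Pv))

  internal∈ : ∀ {u v x} (p : Walk G u v) → x ∈ vertices G p → x ≢ u → x ≢ v → x ∈ internal G p
  internal∈ (here _)       (here refl) x≢u _ = ⊥-elim (x≢u refl)
  internal∈ (step _ _ _ _) (here refl) x≢u _ = ⊥-elim (x≢u refl)
  internal∈ (step _ _ _ p) (there x∈)  _ x≢v = init∈ p x∈ x≢v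
    where
    init∈ : ∀ {u v x} (r : Walk G u v) → x ∈ vertices G r → x ≢ v → x ∈ initVertices G r
    init∈ (here _)       (here refl) x≢v = ⊥-elim (x≢v refl)
    init∈ (step _ _ _ _) (here refl) _   = here refl
    init∈ (step _ _ _ r) (there x∈)  x≢v = there (init∈ r x∈ x≢v)

  rainbow-separates : ∀ {k u v x y} (c : Fin n → Fin k) (p : Walk G u v) → VertexRainbow G c p →
                      x ∈ internal G p → y ∈ internal G p → x ≢ y → c x ≢ c y
  rainbow-separates c p rainbow x∈ y∈ x≢y same = x≢y (map-unique-injective c rainbow x∈ y∈ same)

module Presented {V : Set} (adjV : V → V → Bool)
                 (adjV-sym : ∀ x y → adjV x y ≡ adjV y x) (adjV-irrefl : ∀ x → adjV x x ≡ false)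
                 {N : ℕ} (enc : V → Fin N) (dec : Fin N → V)
                 (dec-enc : ∀ x → dec (enc x) ≡ x) (enc-dec : ∀ u → enc (dec u) ≡ u) where

  graph : Graph N
  graph = record { adj    = λ u v → adjV (dec u) (dec v)
                 ; symm   = λ u v → adjV-sym (dec u) (dec v)
                 ; irrefl = λ u → adjV-irrefl (dec u) }

  open WalkFacts graph public

  enc-injective : ∀ {x y} → enc x ≡ enc y → x ≡ y
  enc-injective {x} {y} e = trans (sym (dec-enc x)) (trans (cong dec e) (dec-enc y))

  enc-≢ : ∀ {x y} → x ≢ y → enc x ≢ enc y
  enc-≢ x≢y e = x≢y (enc-injective e)

  edge : ∀ {x y} → adjV x y ≡ true → Adj graph (enc x) (enc y)
  edge {x} {y} = subst₂ (λ a b → adjV a b ≡ true) (sym (dec-enc x)) (sym (dec-enc y))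

  non-edge : ∀ {x y} → adjV x y ≡ false → ¬ Adj graph (enc x) (enc y)
  non-edge {x} {y} absent e
    with () ← trans (sym absent) (subst₂ (λ a b → adjV a b ≡ true) (dec-enc x) (dec-enc y) e)

  adjacent-distinct : ∀ {x y} → adjV x y ≡ true → x ≢ y
  adjacent-distinct {x} e refl with () ← trans (sym (adjV-irrefl x)) e

  edge-from : ∀ {x w} → Adj graph (enc x) w → adjV x (dec w) ≡ true
  edge-from {x} {w} = subst (λ a → adjV a (dec w) ≡ true) (dec-enc x)

  edge-into : ∀ {x w} → Adj graph w (enc x) → adjV x (dec w) ≡ true
  edge-into {x} {w} e = edge-from (trans (adjV-sym (dec (enc x)) (dec w)) e)

  named : ∀ {u x} → dec u ≡ x → u ≡ enc x
  named {u} e = trans (sym (enc-dec u)) (cong enc e)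

  internal-named : ∀ {u v} x (p : Walk graph (enc u) (enc v)) → enc x ∈ vertices graph p → x ≢ u → x ≢ v →
                   enc x ∈ internal graph p
  internal-named x p x∈ x≢u x≢v = internal∈ p x∈ (enc-≢ x≢u) (enc-≢ x≢v)

  every-pair : {P : Fin N → Fin N → Set} → (∀ x y → P (enc x) (enc y)) → ∀ u v → P u v
  every-pair {P} f u v = subst₂ P (enc-dec u) (enc-dec v) (f (dec u) (dec v))

  Chain : V → List V → V → Set
  Chain x []       y = adjV x y ≡ true
  Chain x (z ∷ zs) y = adjV x z ≡ true × Chain z zs y

  chain-++ : ∀ {x z y} xs ys → Chain x xs z → Chain z ys y → Chain x (xs ++ z ∷ ys) y
  chain-++ []       ys xz       zy = xz , zy
  chain-++ (_ ∷ xs) ys (e , xz) zy = e , chain-++ xs ys xz zy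

  chain-reverse : ∀ {x y} zs → Chain x zs y → Chain y (reverse zs) x
  chain-reverse {x} {y} []       e        = trans (adjV-sym y x) e
  chain-reverse {x} {y} (z ∷ zs) (e , zy) =
    subst (λ ws → Chain y ws x) (sym (unfold-reverse z zs))
          (chain-++ (reverse zs) [] (chain-reverse zs zy) (trans (adjV-sym z x) e))

  record Route (x y : V) : Set where
    field
      inner    : List V
      chain    : Chain x inner y
      distinct : Unique (x ∷ inner ++ y ∷ [])
  open Route public

  chain-walk : ∀ x zs y → Chain x zs y → Walk graph (enc x) (enc y)
  chain-walk x []       y e        = step (enc x) (enc y) (edge e) (here (enc y))
  chain-walk x (z ∷ zs) y (e , zy) = step (enc x) (enc z) (edge e) (chain-walk z zs y zy)

  walk : ∀ {x y} → Route x y → Walk graph (enc x) (enc y)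
  walk {x} {y} R = chain-walk x (inner R) y (chain R)

  walk-len : ∀ {x y} (R : Route x y) → len graph (walk R) ≡ suc (length (inner R))
  walk-len {x} {y} R = go x (inner R) y (chain R)
    where
    go : ∀ x zs y (ch : Chain x zs y) → len graph (chain-walk x zs y ch) ≡ suc (length zs)
    go x []       y _        = refl
    go x (z ∷ zs) y (_ , zy) = cong suc (go z zs y zy)

  walk-vertices : ∀ x zs y (ch : Chain x zs y) →
                  vertices graph (chain-walk x zs y ch) ≡ map enc (x ∷ zs ++ y ∷ [])
  walk-vertices x []       y _        = refl
  walk-vertices x (z ∷ zs) y (_ , zy) = cong (enc x ∷_) (walk-vertices z zs y zy)

  walk-internal : ∀ {x y} (R : Route x y) → internal graph (walk R) ≡ map enc (inner R)
  walk-internal {x} {y} R = go x (inner R) y (chain R)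
    where
    init : ∀ x zs y (ch : Chain x zs y) → initVertices graph (chain-walk x zs y ch) ≡ map enc (x ∷ zs)
    init x []       y _        = refl
    init x (z ∷ zs) y (_ , zy) = cong (enc x ∷_) (init z zs y zy)
    go : ∀ x zs y (ch : Chain x zs y) → internal graph (chain-walk x zs y ch) ≡ map enc zs
    go x []       y _        = refl
    go x (z ∷ zs) y (_ , zy) = init z zs y zy

  walk-path : ∀ {x y} (R : Route x y) → IsPath graph (walk R)
  walk-path {x} {y} R = subst Unique (sym (walk-vertices x (inner R) y (chain R)))
                                (UniqueP.map⁺ enc-injective (distinct R))

  colouring : ∀ {k} → (V → Fin k) → Fin N → Fin k
  colouring c u = c (dec u)

  walk-rainbow : ∀ {k x y} (c : V → Fin k) (R : Route x y) → Unique (map c (inner R)) →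
                 VertexRainbow graph (colouring c) (walk R)
  walk-rainbow c R u = subst (λ zs → Unique (map (colouring c) zs)) (sym (walk-internal R))
                             (subst Unique (sym (recolour (inner R))) u)
    where
    recolour : ∀ zs → map (colouring c) (map enc zs) ≡ map c zs
    recolour []       = refl
    recolour (z ∷ zs) = cong₂ _∷_ (cong c (dec-enc z)) (recolour zs)

  geodesic-bound : ∀ {x y} {g : Walk graph (enc x) (enc y)} → IsGeodesic graph g → (R : Route x y) →
                   len graph g ≤ suc (length (inner R))
  geodesic-bound (_ , shortest) R = ≤-trans (shortest (walk R) (walk-path R)) (≤-reflexive (walk-len R))

  data Near (x y : V) : Set where
    adjacent : adjV x y ≡ true → Near x y
    via      : ∀ z → adjV x z ≡ true → adjV z y ≡ true → x ≢ y → adjV x y ≡ false → Near x y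

  near-sym : ∀ {x y} → Near x y → Near y x
  near-sym {x} {y} (adjacent e)           = adjacent (trans (adjV-sym y x) e)
  near-sym {x} {y} (via z e f x≢y nonadj) =
    via z (trans (adjV-sym y z) f) (trans (adjV-sym z x) e) (λ y≡x → x≢y (sym y≡x))
          (trans (adjV-sym y x) nonadj)

  distance : ∀ {x y} → Near x y → ℕ
  distance (adjacent _)    = 1
  distance (via _ _ _ _ _) = 2

  near-route : ∀ {x y} → Near x y → Route x y
  near-route (adjacent e) =
    record { inner = [] ; chain = e ; distinct = (adjacent-distinct e ∷ []) ∷ [] ∷ [] }
  near-route (via z e f x≢y _) =
    record { inner = z ∷ [] ; chain = e , f
           ; distinct = (adjacent-distinct e ∷ x≢y ∷ []) ∷ (adjacent-distinct f ∷ []) ∷ [] ∷ [] }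

  near-length : ∀ {x y} (n : Near x y) → suc (length (inner (near-route n))) ≡ distance n
  near-length (adjacent _)    = refl
  near-length (via _ _ _ _ _) = refl

  near-minLen : ∀ {x y} (n : Near x y) → MinLen (distance n) (enc x) (enc y)
  near-minLen (adjacent e)           = minLen-distinct (enc-≢ (adjacent-distinct e))
  near-minLen (via _ _ _ x≢y nonadj) = minLen-nonadjacent (enc-≢ x≢y) (non-edge nonadj)

  near-minLen⁻ : ∀ {x y} (n : Near x y) → MinLen (distance n) (enc y) (enc x)
  near-minLen⁻ n@(adjacent _)    = near-minLen (near-sym n)
  near-minLen⁻ n@(via _ _ _ _ _) = near-minLen (near-sym n)

  near-geodesic : ∀ {x y} (n : Near x y) → IsGeodesic graph (walk (near-route n))
  near-geodesic n@(adjacent _)    = geodesic (walk (near-route n)) (walk-path (near-route n)) (near-minLen n)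
  near-geodesic n@(via _ _ _ _ _) = geodesic (walk (near-route n)) (walk-path (near-route n)) (near-minLen n)

  -- With at most one inner vertex, the route is rainbow for every colouring.
  near-unique : ∀ {k x y} (c : V → Fin k) (n : Near x y) → Unique (map c (inner (near-route n)))
  near-unique c (adjacent _)    = []
  near-unique c (via _ _ _ _ _) = [] ∷ []

  near-rainbow : ∀ {k x y} (c : V → Fin k) (n : Near x y) →
                 VertexRainbow graph (colouring c) (walk (near-route n))
  near-rainbow c n = walk-rainbow c (near-route n) (near-unique c n)

-- Positions along an arm (a path stem–leaf, attached to the hub at its stem) and along a
-- cycle branch (a path c₁–c₂–c₃–c₄ attached to the hub at both ends, closing a 5-cycle).
pattern stem = zero
pattern leaf = suc zero
pattern c₁ = zero
pattern c₂ = suc zero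
pattern c₃ = suc (suc zero)
pattern c₄ = suc (suc (suc zero))

consecutive : ∀ {k} → Fin k → Fin k → Bool
consecutive a b = does (∣ toℕ a - toℕ b ∣ ℕ.≟ 1)

consecutive-sym : ∀ {k} (a b : Fin k) → consecutive a b ≡ consecutive b a
consecutive-sym a b = cong (λ d → does (d ℕ.≟ 1)) (∣-∣-comm (toℕ a) (toℕ b))

consecutive-irrefl : ∀ {k} (a : Fin k) → consecutive a a ≡ false
consecutive-irrefl a = cong (λ d → does (d ℕ.≟ 1)) (∣n-n∣≡0 (toℕ a))

same : ∀ {k} → Fin k → Fin k → Bool
same i j = does (i ≟ᶠ j)

same-refl : ∀ {k} (i : Fin k) → same i i ≡ true
same-refl i = dec-true (i ≟ᶠ i) refl

same-sym : ∀ {k} (i j : Fin k) → same i j ≡ same j i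
same-sym i j with i ≟ᶠ j | j ≟ᶠ i
... | yes _   | yes _   = refl
... | no _    | no _    = refl
... | yes i≡j | no j≢i  = ⊥-elim (j≢i (sym i≡j))
... | no i≢j  | yes j≡i = ⊥-elim (i≢j (sym j≡i))

same-sound : ∀ {k} {i j : Fin k} → same i j ≡ true → i ≡ j
same-sound {i = i} {j} e with i ≟ᶠ j
... | yes i≡j = i≡j

∧-true : ∀ {a b} → a ∧ b ≡ true → b ≡ true
∧-true {true} e = e

module Bouquet (m t : ℕ) where

  data V : Set where
    hub : V
    arm : Fin m → Fin 2 → V
    cyc : Fin t → Fin 4 → V

  -- The positions joined to the hub.
  armEnd : Fin 2 → Bool
  armEnd stem = true
  armEnd leaf = false

  cycEnd : Fin 4 → Bool
  cycEnd c₁ = true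
  cycEnd c₂ = false
  cycEnd c₃ = false
  cycEnd c₄ = true

  adjV : V → V → Bool
  adjV hub       hub       = false
  adjV hub       (arm _ a) = armEnd a
  adjV hub       (cyc _ g) = cycEnd g
  adjV (arm _ a) hub       = armEnd a
  adjV (cyc _ g) hub       = cycEnd g
  adjV (arm i a) (arm j b) = consecutive a b ∧ same i j
  adjV (cyc i g) (cyc j h) = consecutive g h ∧ same i j
  adjV (arm _ _) (cyc _ _) = false
  adjV (cyc _ _) (arm _ _) = false

  adjV-sym : ∀ x y → adjV x y ≡ adjV y x
  adjV-sym hub       hub       = refl
  adjV-sym hub       (arm _ _) = refl
  adjV-sym hub       (cyc _ _) = refl
  adjV-sym (arm _ _) hub       = refl
  adjV-sym (cyc _ _) hub       = refl
  adjV-sym (arm i a) (arm j b) = cong₂ _∧_ (consecutive-sym a b) (same-sym i j)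
  adjV-sym (cyc i g) (cyc j h) = cong₂ _∧_ (consecutive-sym g h) (same-sym i j)
  adjV-sym (arm _ _) (cyc _ _) = refl
  adjV-sym (cyc _ _) (arm _ _) = refl

  adjV-irrefl : ∀ x → adjV x x ≡ false
  adjV-irrefl hub       = refl
  adjV-irrefl (arm i a) = cong (_∧ same i i) (consecutive-irrefl a)
  adjV-irrefl (cyc i g) = cong (_∧ same i i) (consecutive-irrefl g)

  N : ℕ
  N = suc (m * 2 + t * 4)

  enc : V → Fin N
  enc hub       = zero
  enc (arm i a) = suc (join (m * 2) (t * 4) (inj₁ (combine i a)))
  enc (cyc j g) = suc (join (m * 2) (t * 4) (inj₂ (combine j g)))

  decode : Fin (m * 2) ⊎ Fin (t * 4) → V
  decode (inj₁ u) = uncurry arm (remQuot {m} 2 u)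
  decode (inj₂ u) = uncurry cyc (remQuot {t} 4 u)

  dec : Fin N → V
  dec zero    = hub
  dec (suc u) = decode (splitAt (m * 2) u)

  dec-enc : ∀ x → dec (enc x) ≡ x
  dec-enc hub       = refl
  dec-enc (arm i a) = trans (cong decode (splitAt-join (m * 2) (t * 4) (inj₁ (combine i a))))
                            (cong (uncurry arm) (remQuot-combine i a))
  dec-enc (cyc j g) = trans (cong decode (splitAt-join (m * 2) (t * 4) (inj₂ (combine j g))))
                            (cong (uncurry cyc) (remQuot-combine j g))

  enc-decode : ∀ s → enc (decode s) ≡ suc (join (m * 2) (t * 4) s)
  enc-decode (inj₁ u) = cong (λ v → suc (join (m * 2) (t * 4) (inj₁ v))) (combine-remQuot {m} 2 u)
  enc-decode (inj₂ u) = cong (λ v → suc (join (m * 2) (t * 4) (inj₂ v))) (combine-remQuot {t} 4 u)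

  enc-dec : ∀ u → enc (dec u) ≡ u
  enc-dec zero    = refl
  enc-dec (suc u) = trans (enc-decode (splitAt (m * 2) u)) (cong suc (join-splitAt (m * 2) (t * 4) u))

  open Presented adjV adjV-sym adjV-irrefl enc dec dec-enc enc-dec public

  Br : Set
  Br = Fin m ⊎ Fin t

  data In : Br → V → Set where
    on-arm : ∀ {i a} → In (inj₁ i) (arm i a)
    on-cyc : ∀ {j g} → In (inj₂ j) (cyc j g)

  in-dec : ∀ β x → Dec (In β x)
  in-dec β        hub       = no λ ()
  in-dec (inj₁ i) (cyc _ _) = no λ ()
  in-dec (inj₂ j) (arm _ _) = no λ ()
  in-dec (inj₁ i) (arm k a) with i ≟ᶠ k
  ... | yes refl = yes on-arm
  ... | no i≢k   = no λ { on-arm → i≢k refl }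
  in-dec (inj₂ j) (cyc k g) with j ≟ᶠ k
  ... | yes refl = yes on-cyc
  ... | no j≢k   = no λ { on-cyc → j≢k refl }

  in? : (β : Br) → Decidable (λ u → In β (dec u))
  in? β u = in-dec β (dec u)

  in-unique : ∀ {β γ x} → In β x → In γ x → β ≡ γ
  in-unique on-arm on-arm = refl
  in-unique on-cyc on-cyc = refl

  neighbour : ∀ {β x y} → In β x → adjV x y ≡ true → y ≡ hub ⊎ In β y
  neighbour {y = hub}     on-arm _ = inj₁ refl
  neighbour {y = hub}     on-cyc _ = inj₁ refl
  neighbour {x = arm i a} {arm k b} on-arm e with refl ← same-sound {i = i} {k} (∧-true e) = inj₂ on-arm
  neighbour {x = cyc j g} {cyc k h} on-cyc e with refl ← same-sound {i = j} {k} (∧-true e) = inj₂ on-cyc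

  leaf-neighbour : ∀ {i y} → adjV (arm i leaf) y ≡ true → y ≡ arm i stem
  leaf-neighbour {y = hub}        ()
  leaf-neighbour {y = arm k stem} e  = cong (λ j → arm j stem) (sym (same-sound e))
  leaf-neighbour {y = arm k leaf} ()
  leaf-neighbour {y = cyc _ _}    ()

  c₂-neighbour : ∀ {j y} → adjV (cyc j c₂) y ≡ true → y ≡ cyc j c₁ ⊎ y ≡ cyc j c₃
  c₂-neighbour {y = hub}      ()
  c₂-neighbour {y = arm _ _}  ()
  c₂-neighbour {y = cyc k c₁} e  = inj₁ (cong (λ i → cyc i c₁) (sym (same-sound e)))
  c₂-neighbour {y = cyc k c₂} ()
  c₂-neighbour {y = cyc k c₃} e  = inj₂ (cong (λ i → cyc i c₃) (sym (same-sound e)))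
  c₂-neighbour {y = cyc k c₄} ()

  to-hub : ∀ {β x} → In β x → Near x hub
  to-hub {x = arm i stem} _ = adjacent refl
  to-hub {x = arm i leaf} _ = via (arm i stem) (same-refl i) refl (λ ()) refl
  to-hub {x = cyc j c₁}   _ = adjacent refl
  to-hub {x = cyc j c₂}   _ = via (cyc j c₁) (same-refl j) refl (λ ()) refl
  to-hub {x = cyc j c₃}   _ = via (cyc j c₄) (same-refl j) refl (λ ()) refl
  to-hub {x = cyc j c₄}   _ = adjacent refl

  data Placement (x y : V) : Set where
    equal : x ≡ y → Placement x y
    near  : Near x y → Placement x y
    apart : ∀ {β γ} → In β x → In γ y → β ≢ γ → Placement x y

  arm-local : ∀ i a b → Placement (arm i a) (arm i b)
  arm-local i stem stem = equal refl
  arm-local i stem leaf = near (adjacent (same-refl i))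
  arm-local i leaf stem = near (adjacent (same-refl i))
  arm-local i leaf leaf = equal refl

  cyc-local : ∀ j g h → Placement (cyc j g) (cyc j h)
  cyc-local j c₁ c₁ = equal refl
  cyc-local j c₁ c₂ = near (adjacent (same-refl j))
  cyc-local j c₁ c₃ = near (via (cyc j c₂) (same-refl j) (same-refl j) (λ ()) refl)
  cyc-local j c₁ c₄ = near (via hub refl refl (λ ()) refl)
  cyc-local j c₂ c₁ = near (adjacent (same-refl j))
  cyc-local j c₂ c₂ = equal refl
  cyc-local j c₂ c₃ = near (adjacent (same-refl j))
  cyc-local j c₂ c₄ = near (via (cyc j c₃) (same-refl j) (same-refl j) (λ ()) refl)
  cyc-local j c₃ c₁ = near (via (cyc j c₂) (same-refl j) (same-refl j) (λ ()) refl)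
  cyc-local j c₃ c₂ = near (adjacent (same-refl j))
  cyc-local j c₃ c₃ = equal refl
  cyc-local j c₃ c₄ = near (adjacent (same-refl j))
  cyc-local j c₄ c₁ = near (via hub refl refl (λ ()) refl)
  cyc-local j c₄ c₂ = near (via (cyc j c₃) (same-refl j) (same-refl j) (λ ()) refl)
  cyc-local j c₄ c₃ = near (adjacent (same-refl j))
  cyc-local j c₄ c₄ = equal refl

  classify : ∀ x y → Placement x y
  classify hub       hub       = equal refl
  classify hub       (arm i a) = near (near-sym (to-hub (on-arm {i} {a})))
  classify hub       (cyc j g) = near (near-sym (to-hub (on-cyc {j} {g})))
  classify (arm i a) hub       = near (to-hub on-arm)
  classify (cyc j g) hub       = near (to-hub on-cyc)
  classify (arm i a) (cyc j g) = apart on-arm on-cyc (λ ())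
  classify (cyc j g) (arm i a) = apart on-cyc on-arm (λ ())
  classify (arm i a) (arm k b) with i ≟ᶠ k
  ... | yes refl = arm-local i a b
  ... | no i≢k   = apart on-arm on-arm (λ e → i≢k (SumP.inj₁-injective e))
  classify (cyc j g) (cyc k h) with j ≟ᶠ k
  ... | yes refl = cyc-local j g h
  ... | no j≢k   = apart on-cyc on-cyc (λ e → j≢k (SumP.inj₂-injective e))

  record HubRoute (β : Br) (x : V) : Set where
    field
      route  : Route x hub
      inside : All (In β) (x ∷ inner route)
  open HubRoute public

  short : ∀ {β x} → In β x → HubRoute β x
  short b = record { route = near-route (to-hub b) ; inside = b ∷ gates b }
    where
    gates : ∀ {β x} (b : In β x) → All (In β) (inner (near-route (to-hub b)))
    gates {x = arm i stem} on-arm = []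
    gates {x = arm i leaf} on-arm = on-arm ∷ []
    gates {x = cyc j c₁}   on-cyc = []
    gates {x = cyc j c₂}   on-cyc = on-cyc ∷ []
    gates {x = cyc j c₃}   on-cyc = on-cyc ∷ []
    gates {x = cyc j c₄}   on-cyc = []

  cross : ∀ {β γ x y} → HubRoute β x → HubRoute γ y → β ≢ γ → Route x y
  cross {β} {γ} {x} {y} Rx Ry β≢γ = record
    { inner    = xs ++ hub ∷ reverse ys
    ; chain    = chain-++ xs (reverse ys) (chain (route Rx)) (chain-reverse ys (chain (route Ry)))
    ; distinct = subst Unique (sym shape)
                   (unique-join (unique-prefix (x ∷ xs) (distinct (route Rx)))
                                (unique-prefix (y ∷ ys) (distinct (route Ry)))
                                (hub-fresh Rx) (hub-fresh Ry) separated) }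
    where
    xs = inner (route Rx)
    ys = inner (route Ry)
    shape : x ∷ (xs ++ hub ∷ reverse ys) ++ y ∷ [] ≡ (x ∷ xs) ++ hub ∷ reverse (y ∷ ys)
    shape = cong (x ∷_) (begin
      (xs ++ hub ∷ reverse ys) ++ y ∷ [] ≡⟨ ++-assoc xs (hub ∷ reverse ys) (y ∷ []) ⟩
      xs ++ hub ∷ reverse ys ++ y ∷ []   ≡⟨ cong (λ zs → xs ++ hub ∷ zs) (unfold-reverse y ys) ⟨
      xs ++ hub ∷ reverse (y ∷ ys)       ∎)
    hub-fresh : ∀ {δ z} (R : HubRoute δ z) → hub ∉ z ∷ inner (route R)
    hub-fresh R h∈ with () ← All.lookup (inside R) h∈
    separated : Disjoint (x ∷ xs) (y ∷ ys)
    separated (z∈xs , z∈ys) =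
      β≢γ (in-unique (All.lookup (inside Rx) z∈xs) (All.lookup (inside Ry) z∈ys))

  cross-length : ∀ {β γ x y} (Rx : HubRoute β x) (Ry : HubRoute γ y) (β≢γ : β ≢ γ) →
                 suc (length (inner (cross Rx Ry β≢γ)))
                 ≡ suc (length (inner (route Rx))) + suc (length (inner (route Ry)))
  cross-length Rx Ry _ = cong suc (begin
    length (xs ++ hub ∷ reverse ys)       ≡⟨ length-++ xs ⟩
    length xs + suc (length (reverse ys)) ≡⟨ cong (λ k → length xs + suc k) (length-reverse ys) ⟩
    length xs + suc (length ys)           ∎)
    where
    xs = inner (route Rx)
    ys = inner (route Ry)

  cross-rainbow : ∀ {k β γ x y} (c : V → Fin k) (Rx : HubRoute β x) (Ry : HubRoute γ y) (β≢γ : β ≢ γ) →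
                  let cxs = map c (inner (route Rx)) ; cys = map c (inner (route Ry)) in
                  Unique cxs → Unique cys → c hub ∉ cxs → c hub ∉ cys → Disjoint cxs cys →
                  VertexRainbow graph (colouring c) (walk (cross Rx Ry β≢γ))
  cross-rainbow c Rx Ry β≢γ ux uy hx hy dis =
    walk-rainbow c (cross Rx Ry β≢γ) (subst Unique (sym colours) (unique-join ux uy hx hy dis))
    where
    xs = inner (route Rx)
    ys = inner (route Ry)
    colours : map c (xs ++ hub ∷ reverse ys) ≡ map c xs ++ c hub ∷ reverse (map c ys)
    colours = trans (map-++ c xs (hub ∷ reverse ys))
                    (cong (λ zs → map c xs ++ c hub ∷ zs) (reverse-map c ys))

  leaves-branch : ∀ {β x y} → In β x → ¬ In β y → (p : Walk graph (enc x) (enc y)) →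
                  enc hub ∈ vertices graph p
  leaves-branch {β} {x} {y} bx ¬by p =
    leaves-via (in? β) p only (subst (In β) (sym (dec-enc x)) bx) (λ b → ¬by (subst (In β) (dec-enc y) b))
    where
    only : ∀ u w → Adj graph u w → In β (dec u) → ¬ In β (dec w) → w ∈ vertices graph p → w ≡ enc hub
    only _ _ e bu ¬bw _ with neighbour bu e
    ... | inj₁ w-hub = named w-hub
    ... | inj₂ bw    = ⊥-elim (¬bw bw)

  depth : ∀ {β x} → In β x → ℕ
  depth b = distance (to-hub b)

  apart-minLen : ∀ {β γ x y} (bx : In β x) (by : In γ y) → β ≢ γ →
                 MinLen (depth bx + depth by) (enc x) (enc y)
  apart-minLen bx by β≢γ =
    minLen-via (leaves-branch bx (λ b → β≢γ (in-unique b by)))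
               (near-minLen (to-hub bx)) (near-minLen⁻ (to-hub by))

  short-cross-geodesic : ∀ {β γ x y} (bx : In β x) (by : In γ y) (β≢γ : β ≢ γ) →
                         IsGeodesic graph (walk (cross (short bx) (short by) β≢γ))
  short-cross-geodesic bx by β≢γ =
    geodesic (walk R) (walk-path R) (subst (λ d → MinLen d _ _) (sym length≡) (apart-minLen bx by β≢γ))
    where
    R = cross (short bx) (short by) β≢γ
    length≡ : len graph (walk R) ≡ depth bx + depth by
    length≡ = trans (walk-len R) (trans (cross-length (short bx) (short by) β≢γ)
                                        (cong₂ _+_ (near-length (to-hub bx)) (near-length (to-hub by))))

  branchColour : Br → Fin (suc (m + t))
  branchColour β = suc (join m t β)

  branchColour-injective : ∀ {β γ} → branchColour β ≡ branchColour γ → β ≡ γ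
  branchColour-injective {β} {γ} e =
    trans (sym (splitAt-join m t β)) (trans (cong (splitAt m) (suc-injective e)) (splitAt-join m t γ))

  strongColour : V → Fin (suc (m + t))
  strongColour (arm i stem) = branchColour (inj₁ i)
  strongColour (cyc j c₁)   = branchColour (inj₂ j)
  strongColour (cyc j c₄)   = branchColour (inj₂ j)
  strongColour _            = zero

  short-colours : ∀ {β x} (b : In β x) →
                  All (_≡ branchColour β) (map strongColour (inner (route (short b))))
  short-colours {x = arm i stem} on-arm = []
  short-colours {x = arm i leaf} on-arm = refl ∷ []
  short-colours {x = cyc j c₁}   on-cyc = []
  short-colours {x = cyc j c₂}   on-cyc = refl ∷ []
  short-colours {x = cyc j c₃}   on-cyc = refl ∷ []
  short-colours {x = cyc j c₄}   on-cyc = []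

  StrongPath : Fin N → Fin N → Set
  StrongPath u v = Σ (Walk graph u v) λ r → IsGeodesic graph r × VertexRainbow graph (colouring strongColour) r

  strong-connected : StrongRainbowVertexConnected graph (colouring strongColour)
  strong-connected = every-pair {P = StrongPath} pair
    where
    pair : ∀ x y → StrongPath (enc x) (enc y)
    pair x y with classify x y
    ... | equal refl      = here (enc x) , stay-geodesic (enc x) , []
    ... | near n          = walk (near-route n) , near-geodesic n , near-rainbow strongColour n
    ... | apart bx by β≢γ =
      walk (cross (short bx) (short by) β≢γ) , short-cross-geodesic bx by β≢γ ,
      cross-rainbow strongColour (short bx) (short by) β≢γ
        (near-unique strongColour (to-hub bx)) (near-unique strongColour (to-hub by))
        (constant-∉ (short-colours bx) (λ ())) (constant-∉ (short-colours by) (λ ()))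
        (constant-disjoint (short-colours bx) (short-colours by) (β≢γ ∘ branchColour-injective))

module Construction (m' t : ℕ) where

  -- Three arms at least, so that the rainbow colouring below can use colours 1, 2, 3 on the cycles.
  M : ℕ
  M = suc (suc (suc m'))

  open Bouquet M t public

  rainbowColour : V → Fin (suc M)
  rainbowColour hub          = zero
  rainbowColour (arm i stem) = suc i
  rainbowColour (arm i leaf) = zero
  rainbowColour (cyc j c₁)   = suc zero
  rainbowColour (cyc j c₂)   = suc (suc (suc zero))
  rainbowColour (cyc j c₃)   = suc (suc (suc zero))
  rainbowColour (cyc j c₄)   = suc (suc zero)

  -- The colour met on the shortest route from x to the hub (if any vertex is met at all).
  tone : V → Fin (suc M)
  tone (arm i _)  = suc i
  tone (cyc _ c₃) = suc (suc zero)
  tone _          = suc zero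

  0≢tone : ∀ x → zero ≢ tone x
  0≢tone hub        ()
  0≢tone (arm _ _)  ()
  0≢tone (cyc _ c₁) ()
  0≢tone (cyc _ c₂) ()
  0≢tone (cyc _ c₃) ()
  0≢tone (cyc _ c₄) ()

  short-tone : ∀ {β x} (b : In β x) → All (_≡ tone x) (map rainbowColour (inner (route (short b))))
  short-tone {x = arm i stem} on-arm = []
  short-tone {x = arm i leaf} on-arm = refl ∷ []
  short-tone {x = cyc j c₁}   on-cyc = []
  short-tone {x = cyc j c₂}   on-cyc = refl ∷ []
  short-tone {x = cyc j c₃}   on-cyc = refl ∷ []
  short-tone {x = cyc j c₄}   on-cyc = []

  record Avoiding (a : Fin (suc M)) (β : Br) (x : V) : Set where
    field
      hubRoute  : HubRoute β x
      rainbow   : Unique (map rainbowColour (inner (route hubRoute)))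
      clear-hub : zero ∉ map rainbowColour (inner (route hubRoute))
      clear-a   : a ∉ map rainbowColour (inner (route hubRoute))
  open Avoiding

  long-c₂ : ∀ j → HubRoute (inj₂ j) (cyc j c₂)
  long-c₂ j = record
    { route  = record { inner = cyc j c₃ ∷ cyc j c₄ ∷ [] ; chain = same-refl j , same-refl j , refl
                      ; distinct = ((λ ()) ∷ (λ ()) ∷ (λ ()) ∷ []) ∷ ((λ ()) ∷ (λ ()) ∷ [])
                                   ∷ ((λ ()) ∷ []) ∷ [] ∷ [] }
    ; inside = on-cyc ∷ on-cyc ∷ on-cyc ∷ [] }

  long-c₃ : ∀ j → HubRoute (inj₂ j) (cyc j c₃)
  long-c₃ j = record
    { route  = record { inner = cyc j c₂ ∷ cyc j c₁ ∷ [] ; chain = same-refl j , same-refl j , refl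
                      ; distinct = ((λ ()) ∷ (λ ()) ∷ (λ ()) ∷ []) ∷ ((λ ()) ∷ (λ ()) ∷ [])
                                   ∷ ((λ ()) ∷ []) ∷ [] ∷ [] }
    ; inside = on-cyc ∷ on-cyc ∷ on-cyc ∷ [] }

  -- A cycle vertex reaches the hub avoiding any given colour a: the short route meets colour 1 (from c₂)
  -- or 2 (from c₃) only, and when that is a, the long way meets colours 3, 2 or 3, 1 instead.
  avoiding : ∀ a j g → Avoiding a (inj₂ j) (cyc j g)
  avoiding a j c₁ = record { hubRoute = short on-cyc ; rainbow = [] ; clear-hub = λ () ; clear-a = λ () }
  avoiding a j c₄ = record { hubRoute = short on-cyc ; rainbow = [] ; clear-hub = λ () ; clear-a = λ () }
  avoiding a j c₂ with a ≟ᶠ suc zero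
  ... | no a≢1   = record { hubRoute = short on-cyc ; rainbow = [] ∷ [] ; clear-hub = λ { (here ()) }
                          ; clear-a = λ { (here a≡1) → a≢1 a≡1 } }
  ... | yes refl = record { hubRoute = long-c₂ j ; rainbow = ((λ ()) ∷ []) ∷ [] ∷ []
                          ; clear-hub = λ { (here ()) ; (there (here ())) }
                          ; clear-a = λ { (here ()) ; (there (here ())) } }
  avoiding a j c₃ with a ≟ᶠ suc (suc zero)
  ... | no a≢2   = record { hubRoute = short on-cyc ; rainbow = [] ∷ [] ; clear-hub = λ { (here ()) }
                          ; clear-a = λ { (here a≡2) → a≢2 a≡2 } }
  ... | yes refl = record { hubRoute = long-c₃ j ; rainbow = ((λ ()) ∷ []) ∷ [] ∷ []
                          ; clear-hub = λ { (here ()) ; (there (here ())) }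
                          ; clear-a = λ { (here ()) ; (there (here ())) } }

  RainbowPath : Fin N → Fin N → Set
  RainbowPath u v = Σ (Walk graph u v) λ r → IsPath graph r × VertexRainbow graph (colouring rainbowColour) r

  -- A cycle endpoint takes a route avoiding the colour met on the other
  -- end's shortest route; two arm vertices use their shortest routes, which meet different stem colours.
  rainbow-cross : ∀ {β γ x y} → In β x → In γ y → β ≢ γ → RainbowPath (enc x) (enc y)
  rainbow-cross {x = cyc j g} {y} on-cyc by β≢γ =
    walk R , walk-path R ,
    cross-rainbow rainbowColour (hubRoute A) (short by) β≢γ (rainbow A) (near-unique rainbowColour (to-hub by))
      (clear-hub A) (constant-∉ (short-tone by) (0≢tone y)) (avoiding-disjoint (clear-a A) (short-tone by))
    where
    A = avoiding (tone y) j g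
    R = cross (hubRoute A) (short by) β≢γ
  rainbow-cross {x = arm i a} {cyc j g} bx@on-arm on-cyc β≢γ =
    walk R , walk-path R ,
    cross-rainbow rainbowColour (short bx) (hubRoute A) β≢γ (near-unique rainbowColour (to-hub bx)) (rainbow A)
      (constant-∉ (short-tone bx) λ ()) (clear-hub A) (DisjointP.sym (avoiding-disjoint (clear-a A) (short-tone bx)))
    where
    A = avoiding (tone (arm i a)) j g
    R = cross (short bx) (hubRoute A) β≢γ
  rainbow-cross {x = arm i a} {arm k b} bx@on-arm by@on-arm β≢γ =
    walk R , walk-path R ,
    cross-rainbow rainbowColour (short bx) (short by) β≢γ
      (near-unique rainbowColour (to-hub bx)) (near-unique rainbowColour (to-hub by))
      (constant-∉ (short-tone bx) λ ()) (constant-∉ (short-tone by) λ ())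
      (constant-disjoint (short-tone bx) (short-tone by) (λ e → β≢γ (cong inj₁ (suc-injective e))))
    where
    R = cross (short bx) (short by) β≢γ

  rainbow-connected : RainbowVertexConnected graph (colouring rainbowColour)
  rainbow-connected = every-pair {P = RainbowPath} pair
    where
    pair : ∀ x y → RainbowPath (enc x) (enc y)
    pair x y with classify x y
    ... | equal refl      = here (enc x) , [] ∷ [] , []
    ... | near n          = walk (near-route n) , walk-path (near-route n) , near-rainbow rainbowColour n
    ... | apart bx by β≢γ = rainbow-cross bx by β≢γ

  module Separation {k} (c : Fin N → Fin k) where

    leaf-exit : ∀ {i v} (r : Walk graph (enc (arm i leaf)) v) → v ≢ enc (arm i leaf) →
                enc (arm i stem) ∈ vertices graph r
    leaf-exit {i} r v≢ = leaves-via (_≟ᶠ enc (arm i leaf)) r only refl v≢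
      where
      only : ∀ y z → Adj graph y z → y ≡ enc (arm i leaf) → z ≢ enc (arm i leaf) →
             z ∈ vertices graph r → z ≡ enc (arm i stem)
      only y z e refl _ _ = named (leaf-neighbour {i} (edge-from {arm i leaf} {z} e))

    leaf-entry : ∀ {i u} (r : Walk graph u (enc (arm i leaf))) → u ≢ enc (arm i leaf) →
                 enc (arm i stem) ∈ vertices graph r
    leaf-entry {i} r u≢ = enters-via (_≟ᶠ enc (arm i leaf)) r only u≢ refl
      where
      only : ∀ y z → Adj graph y z → y ≢ enc (arm i leaf) → z ≡ enc (arm i leaf) →
             y ∈ vertices graph r → y ≡ enc (arm i stem)
      only y z e _ refl _ = named (leaf-neighbour {i} (edge-into {arm i leaf} {y} e))

    leaf-to-leaf : ∀ {i i'} → i ≢ i' →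
                   Σ (Walk graph (enc (arm i leaf)) (enc (arm i' leaf))) (VertexRainbow graph c) →
                   c (enc (arm i stem)) ≢ c (enc (arm i' stem)) × c (enc hub) ≢ c (enc (arm i' stem))
    leaf-to-leaf {i} {i'} i≢i' (r , rainbow) =
        rainbow-separates c r rainbow stem∈ stem'∈ (enc-≢ {arm i stem} {arm i' stem} λ { refl → i≢i' refl })
      , rainbow-separates c r rainbow hub∈ stem'∈ (enc-≢ {hub} {arm i' stem} λ ())
      where
      between : ∀ x → enc x ∈ vertices graph r → x ≢ arm i leaf → x ≢ arm i' leaf → enc x ∈ internal graph r
      between x = internal-named x r
      leaves≢ : arm i' leaf ≢ arm i leaf
      leaves≢ refl = i≢i' refl
      stem∈ : enc (arm i stem) ∈ internal graph r
      stem∈ = between (arm i stem) (leaf-exit {i} r (enc-≢ leaves≢)) (λ ()) (λ ())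
      stem'∈ : enc (arm i' stem) ∈ internal graph r
      stem'∈ = between (arm i' stem) (leaf-entry {i'} r (enc-≢ (leaves≢ ∘ sym))) (λ ()) (λ ())
      hub∈ : enc hub ∈ internal graph r
      hub∈ = between hub (leaves-branch {y = arm i' leaf} (on-arm {i} {leaf}) (λ { on-arm → i≢i' refl }) r)
                     (λ ()) (λ ())

    -- A walk of length at most four from c₂ of cycle j to a vertex four steps away from c₃ leaves
    -- through c₁, since leaving through c₃ would already cost five steps; symmetrically for entering.
    c₂-exit : ∀ {j y} (g : Walk graph (enc (cyc j c₂)) (enc y)) → len graph g ≤ 4 →
              MinLen 4 (enc (cyc j c₃)) (enc y) → y ≢ cyc j c₂ → enc (cyc j c₁) ∈ vertices graph g
    c₂-exit {j} {y} g short far y≢ = leaves-via (_≟ᶠ enc (cyc j c₂)) g only refl (enc-≢ y≢)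
      where
      only : ∀ u z → Adj graph u z → u ≡ enc (cyc j c₂) → z ≢ enc (cyc j c₂) →
             z ∈ vertices graph g → z ≡ enc (cyc j c₁)
      only u z e refl _ z∈ with c₂-neighbour {j} (edge-from {cyc j c₂} {z} e)
      ... | inj₁ z≡c₁ = named z≡c₁
      ... | inj₂ z≡c₃ = ⊥-elim (avoids g (s≤s short) (minLen-distinct (enc-≢ {cyc j c₂} {cyc j c₃} λ ())) far
                                        (subst (_∈ vertices graph g) (named z≡c₃) z∈))

    c₂-entry : ∀ {j x} (g : Walk graph (enc x) (enc (cyc j c₂))) → len graph g ≤ 4 →
               MinLen 4 (enc x) (enc (cyc j c₃)) → x ≢ cyc j c₂ → enc (cyc j c₁) ∈ vertices graph g
    c₂-entry {j} {x} g short far x≢ = enters-via (_≟ᶠ enc (cyc j c₂)) g only (enc-≢ x≢) refl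
      where
      only : ∀ u z → Adj graph u z → u ≢ enc (cyc j c₂) → z ≡ enc (cyc j c₂) →
             u ∈ vertices graph g → u ≡ enc (cyc j c₁)
      only u z e _ refl u∈ with c₂-neighbour {j} (edge-into {cyc j c₂} {u} e)
      ... | inj₁ u≡c₁ = named u≡c₁
      ... | inj₂ u≡c₃ = ⊥-elim (avoids g (s≤s short) far (minLen-distinct (enc-≢ {cyc j c₃} {cyc j c₂} λ ()))
                                        (subst (_∈ vertices graph g) (named u≡c₃) u∈))

    cycle-pair : StrongRainbowVertexConnected graph c → ∀ {j j'} → j ≢ j' →
                 c (enc (cyc j c₁)) ≢ c (enc (cyc j' c₁))
    cycle-pair sc {j} {j'} j≢j' with sc (enc (cyc j c₂)) (enc (cyc j' c₂))
    ... | g , geo , rainbow =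
      rainbow-separates c g rainbow first last (enc-≢ {cyc j c₁} {cyc j' c₁} λ { refl → j≢j' refl })
      where
      between : ∀ x → enc x ∈ vertices graph g → x ≢ cyc j c₂ → x ≢ cyc j' c₂ → enc x ∈ internal graph g
      between x = internal-named x g
      branches≢ : inj₂ j ≢ inj₂ j'
      branches≢ e = j≢j' (SumP.inj₂-injective e)
      bound : len graph g ≤ 4
      bound = geodesic-bound geo (cross (short (on-cyc {j} {c₂})) (short (on-cyc {j'} {c₂})) branches≢)
      first : enc (cyc j c₁) ∈ internal graph g
      first = between (cyc j c₁)
                (c₂-exit {j} {cyc j' c₂} g bound (apart-minLen (on-cyc {j} {c₃}) (on-cyc {j'} {c₂}) branches≢)
                         λ { refl → j≢j' refl })
                (λ ()) (λ ())
      last : enc (cyc j' c₁) ∈ internal graph g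
      last = between (cyc j' c₁)
               (c₂-entry {j'} {cyc j c₂} g bound (apart-minLen (on-cyc {j} {c₂}) (on-cyc {j'} {c₃}) branches≢)
                         λ { refl → j≢j' refl })
               (λ ()) (λ ())

    cycle-arm : StrongRainbowVertexConnected graph c → ∀ j i →
                c (enc (cyc j c₁)) ≢ c (enc hub) × c (enc (cyc j c₁)) ≢ c (enc (arm i stem))
    cycle-arm sc j i with sc (enc (cyc j c₂)) (enc (arm i leaf))
    ... | g , geo , rainbow =
        rainbow-separates c g rainbow c₁∈ hub∈ (enc-≢ {cyc j c₁} {hub} λ ())
      , rainbow-separates c g rainbow c₁∈ stem∈ (enc-≢ {cyc j c₁} {arm i stem} λ ())
      where
      between : ∀ x → enc x ∈ vertices graph g → x ≢ cyc j c₂ → x ≢ arm i leaf → enc x ∈ internal graph g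
      between x = internal-named x g
      bound : len graph g ≤ 4
      bound = geodesic-bound geo (cross (short (on-cyc {j} {c₂})) (short (on-arm {i} {leaf})) λ ())
      c₁∈ : enc (cyc j c₁) ∈ internal graph g
      c₁∈ = between (cyc j c₁)
              (c₂-exit {j} {arm i leaf} g bound (apart-minLen (on-cyc {j} {c₃}) (on-arm {i} {leaf}) λ ()) λ ())
              (λ ()) (λ ())
      hub∈ : enc hub ∈ internal graph g
      hub∈ = between hub (leaves-branch {y = arm i leaf} (on-cyc {j} {c₂}) (λ ()) g) (λ ()) (λ ())
      stem∈ : enc (arm i stem) ∈ internal graph g
      stem∈ = between (arm i stem) (leaf-entry {i} g (enc-≢ {cyc j c₂} {arm i leaf} λ ())) (λ ()) (λ ())

  leaf-walk : ∀ {k} {c : Fin N → Fin k} → RainbowVertexConnected graph c → ∀ i i' →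
              Σ (Walk graph (enc (arm i leaf)) (enc (arm i' leaf))) (VertexRainbow graph c)
  leaf-walk rc i i' with rc (enc (arm i leaf)) (enc (arm i' leaf))
  ... | r , _ , rainbow = r , rainbow

  -- The hub and the M stems must receive pairwise distinct colours in every rainbow colouring.
  armForced : Fin (suc M) → V
  armForced zero    = hub
  armForced (suc i) = arm i stem

  other : Fin M → Fin M
  other zero    = suc zero
  other (suc _) = zero

  other≢ : ∀ i → other i ≢ i
  other≢ zero    ()
  other≢ (suc _) ()

  arm-separated : ∀ {k} (c : Fin N → Fin k) → RainbowVertexConnected graph c →
                  ∀ a b → a ≢ b → c (enc (armForced a)) ≢ c (enc (armForced b))
  arm-separated c rc zero    zero     a≢b = ⊥-elim (a≢b refl)
  arm-separated c rc zero    (suc i)  _   = proj₂ (leaf-to-leaf (other≢ i) (leaf-walk rc (other i) i))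
    where open Separation c
  arm-separated c rc (suc i) zero     _ e = proj₂ (leaf-to-leaf (other≢ i) (leaf-walk rc (other i) i)) (sym e)
    where open Separation c
  arm-separated c rc (suc i) (suc i') a≢b = proj₁ (leaf-to-leaf (a≢b ∘ cong suc) (leaf-walk rc i i'))
    where open Separation c

  -- In a strong rainbow colouring, also the vertex c₁ of every cycle branch needs a colour of its own.
  strongForced : Fin (suc M) ⊎ Fin t → V
  strongForced (inj₁ a) = armForced a
  strongForced (inj₂ j) = cyc j c₁

  strong-separated : ∀ {k} (c : Fin N → Fin k) → StrongRainbowVertexConnected graph c →
                     ∀ s s' → s ≢ s' → c (enc (strongForced s)) ≢ c (enc (strongForced s'))
  strong-separated c sc (inj₁ a)       (inj₁ b)       s≢s' =
    arm-separated c (strong⇒rainbow sc) a b (s≢s' ∘ cong inj₁)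
  strong-separated c sc (inj₁ zero)    (inj₂ j)       _ e = proj₁ (Separation.cycle-arm c sc j zero) (sym e)
  strong-separated c sc (inj₁ (suc i)) (inj₂ j)       _ e = proj₂ (Separation.cycle-arm c sc j i) (sym e)
  strong-separated c sc (inj₂ j)       (inj₁ zero)    _ e = proj₁ (Separation.cycle-arm c sc j zero) e
  strong-separated c sc (inj₂ j)       (inj₁ (suc i)) _ e = proj₂ (Separation.cycle-arm c sc j i) e
  strong-separated c sc (inj₂ j)       (inj₂ j')      s≢s' = Separation.cycle-pair c sc (s≢s' ∘ cong inj₂)

  connected : Connected graph
  connected u v = proj₁ (rainbow-connected u v) , proj₁ (proj₂ (rainbow-connected u v))

  rvc-exact : rvc≡ graph (suc M)
  rvc-exact = (colouring rainbowColour , rainbow-connected) , fewer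
    where
    fewer : ∀ k → k < suc M → ¬ Σ (Fin N → Fin k) (RainbowVertexConnected graph)
    fewer k k<a (c , rc) = <⇒≱ k<a (distinct-colours armForced (c ∘ enc) (arm-separated c rc))

  srvc-exact : srvc≡ graph (suc M + t)
  srvc-exact = (colouring strongColour , strong-connected) , fewer
    where
    forced : Fin (suc M + t) → V
    forced s = strongForced (splitAt (suc M) s)
    split≢ : ∀ s s' → s ≢ s' → splitAt (suc M) s ≢ splitAt (suc M) s'
    split≢ s s' s≢s' e =
      s≢s' (trans (sym (join-splitAt (suc M) t s)) (trans (cong (join (suc M) t) e) (join-splitAt (suc M) t s')))
    fewer : ∀ k → k < suc M + t → ¬ Σ (Fin N → Fin k) (StrongRainbowVertexConnected graph)
    fewer k k<b (c , sc) =
      <⇒≱ k<b (distinct-colours forced (c ∘ enc) λ s s' s≢s' → strong-separated c sc _ _ (split≢ s s' s≢s'))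

lemma4p9 : ∀ (a b : ℕ) → 4 ≤ a → a ≤ b →
    Σ ℕ λ n → Σ (Graph n) λ G → Connected G × rvc≡ G a × srvc≡ G b
lemma4p9 (suc (suc (suc (suc m')))) b (s≤s (s≤s (s≤s (s≤s z≤n)))) a≤b with m≤n⇒∃[o]m+o≡n a≤b
... | t , refl = N , graph , connected , rvc-exact , srvc-exact
  where open Construction m' t
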